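{- Let $k,a,b$ be positive integers such that $k=a+b$ and $4<2a\le k$. Then \[\binom{2k}{k}\neq\binom{2a}{a}\binom{a+2b-2}{b}.\] -}

module Defs where

{-# OPTIONS --safe #-}
-- Write L n = C(2n, n). All quantities involved are rational multiples of L b, by
-- (n+1)·L(n+1) = 2(2n+1)·L n and (m+1)·C(m+k+1, k) = (m+k+1)·C(m+k, k). For a = 3 and a = 4
-- this turns the claim into polynomial inequalities in b: L(b+3) > 20·C(2b+1, b) and
-- L(b+4) < 70·C(2b+2, b). Passing from a to a+1 multiplies L(a+b) by 2(2a+2b+1)/(a+b+1) and
-- L a·C(a+2b-2, b) by the larger factor 2(2a+1)(a+2b-1)/((a+1)(a+b-1)), so the strict
-- inequality at a = 4 persists for every a ≥ 4.
module Submission where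

open import Defs
open import Data.Nat
  using (ℕ; zero; suc; _+_; _*_; _∸_; _≤_; _<_; s≤s; z<s; NonZero; >-nonZero)
open import Data.Nat.Properties
open import Data.Nat.Combinatorics
  using (_C_; nCk+nC[k+1]≡[n+1]C[k+1]; nCk≡nC[n∸k]; nC1≡n)
open import Data.Nat.Tactic.RingSolver using (solve-∀)
open import Relation.Binary.PropositionalEquality
  using (_≡_; _≢_; refl; sym; trans; cong; cong₂; module ≡-Reasoning)
open import Algebra.Properties.CommutativeSemigroup *-commutativeSemigroup
  using (interchange; x∙yz≈y∙xz; xy∙z≈y∙xz; xy∙z≈xz∙y)

private
  variable
    n k x x′ x″ y y′ u p q s t : ℕ

infix 4 _≡[_/_]_

-- x′ ≡[ p / s ] x  records  x′ = (p / s) · x  without dividing.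
record _≡[_/_]_ (x′ p s x : ℕ) : Set where
  constructor ratio
  field
    cross-multiplied : s * x′ ≡ p * x

open _≡[_/_]_

≡[/]-trans : x″ ≡[ q / t ] x′ → x′ ≡[ p / s ] x → x″ ≡[ q * p / t * s ] x
≡[/]-trans {x″} {q} {t} {x′} {p} {s} {x} (ratio e₂) (ratio e₁) = ratio (begin
  (t * s) * x″  ≡⟨ xy∙z≈y∙xz t s x″ ⟩
  s * (t * x″)  ≡⟨ cong (s *_) e₂ ⟩
  s * (q * x′)  ≡⟨ x∙yz≈y∙xz s q x′ ⟩
  q * (s * x′)  ≡⟨ cong (q *_) e₁ ⟩
  q * (p * x)   ≡⟨ *-assoc q p x ⟨
  (q * p) * x   ∎)
  where open ≡-Reasoning

≡[/]-* : x′ ≡[ p / s ] x → y′ ≡[ q / t ] y → x′ * y′ ≡[ p * q / s * t ] x * y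
≡[/]-* {x′} {p} {s} {x} {y′} {q} {t} {y} (ratio e₁) (ratio e₂) = ratio (begin
  (s * t) * (x′ * y′)  ≡⟨ interchange s t x′ y′ ⟩
  (s * x′) * (t * y′)  ≡⟨ cong₂ _*_ e₁ e₂ ⟩
  (p * x) * (q * y)    ≡⟨ interchange p x q y ⟩
  (p * q) * (x * y)    ∎)
  where open ≡-Reasoning

≡[/]-scale : ∀ c → x′ ≡[ p / s ] x → c * x′ ≡[ c * p / s ] x
≡[/]-scale {x′} {p} {s} {x} c (ratio e) = ratio (begin
  s * (c * x′)  ≡⟨ x∙yz≈y∙xz s c x′ ⟩
  c * (s * x′)  ≡⟨ cong (c *_) e ⟩
  c * (p * x)   ≡⟨ *-assoc c p x ⟨
  (c * p) * x   ∎)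
  where open ≡-Reasoning

≡[/]-cross : x′ ≡[ p / s ] x → ∀ t → (s * t) * x′ ≡ (p * t) * x
≡[/]-cross {x′} {p} {s} {x} (ratio e) t = begin
  (s * t) * x′  ≡⟨ xy∙z≈xz∙y s t x′ ⟩
  (s * x′) * t  ≡⟨ cong (_* t) e ⟩
  (p * x) * t   ≡⟨ xy∙z≈xz∙y p x t ⟩
  (p * t) * x   ∎
  where open ≡-Reasoning

≡[/]-preserves-< : .{{NonZero (q * s)}} → x′ ≡[ p / s ] x → y′ ≡[ q / t ] y →
                   p * t ≤ q * s → x < y → x′ < y′
≡[/]-preserves-< {q} {s} {x′} {p} {x} {y′} {t} {y} e₁ e₂ pt≤qs x<y =
  *-cancelˡ-< (s * t) x′ y′ (begin-strict
    (s * t) * x′  ≡⟨ ≡[/]-cross e₁ t ⟩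
    (p * t) * x   ≤⟨ *-monoˡ-≤ x pt≤qs ⟩
    (q * s) * x   <⟨ *-monoʳ-< (q * s) x<y ⟩
    (q * s) * y   ≡⟨ ≡[/]-cross e₂ s ⟨
    (t * s) * y′  ≡⟨ cong (_* y′) (*-comm t s) ⟩
    (s * t) * y′  ∎)
  where open ≤-Reasoning

≡[/]-common-< : .{{NonZero u}} → x ≡[ p / s ] u → y ≡[ q / t ] u → p * t < q * s → x < y
≡[/]-common-< {u} {x} {p} {s} {y} {q} {t} e₁ e₂ pt<qs =
  *-cancelˡ-< (s * t) x y (begin-strict
    (s * t) * x  ≡⟨ ≡[/]-cross e₁ t ⟩
    (p * t) * u  <⟨ *-monoˡ-< u pt<qs ⟩
    (q * s) * u  ≡⟨ ≡[/]-cross e₂ s ⟨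
    (t * s) * y  ≡⟨ cong (_* y) (*-comm t s) ⟩
    (s * t) * y  ∎)
  where open ≤-Reasoning

C-absorption : ∀ n k → suc n C suc k ≡[ suc n / suc k ] n C k
C-absorption zero    zero    = ratio refl
C-absorption zero    (suc k) = ratio (*-zeroʳ (suc (suc k)))
C-absorption (suc n) zero    =
  ratio (trans (+-identityʳ _) (trans (nC1≡n (suc (suc n))) (sym (*-identityʳ _))))
C-absorption (suc n) (suc k) = ratio (begin
  suc (suc k) * (suc (suc n) C suc (suc k))
    ≡⟨ cong (suc (suc k) *_) (pascal (suc n) (suc k)) ⟨
  suc (suc k) * (A + B)
    ≡⟨ *-distribˡ-+ (suc (suc k)) A B ⟩
  (A + suc k * A) + suc (suc k) * B
    ≡⟨ +-assoc A (suc k * A) (suc (suc k) * B) ⟩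
  A + (suc k * A + suc (suc k) * B)
    ≡⟨ cong (A +_) (cong₂ _+_ absorb-A absorb-B) ⟩
  A + (suc n * (n C k) + suc n * (n C suc k))
    ≡⟨ cong (A +_) (*-distribˡ-+ (suc n) (n C k) (n C suc k)) ⟨
  A + suc n * (n C k + n C suc k)
    ≡⟨ cong (λ z → A + suc n * z) (pascal n k) ⟩
  suc (suc n) * A
    ∎)
  where
  open ≡-Reasoning
  pascal : ∀ n k → n C k + n C suc k ≡ suc n C suc k
  pascal = nCk+nC[k+1]≡[n+1]C[k+1]
  A B : ℕ
  A = suc n C suc k
  B = suc n C suc (suc k)
  absorb-A : suc k * A ≡ suc n * (n C k)
  absorb-A = cross-multiplied (C-absorption n k)
  absorb-B : suc (suc k) * B ≡ suc n * (n C suc k)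
  absorb-B = cross-multiplied (C-absorption n (suc k))

C-sym : ∀ m k → (m + k) C k ≡ (m + k) C m
C-sym m k = trans (nCk≡nC[n∸k] (m≤n+m k m)) (cong ((m + k) C_) (m+n∸n≡m m k))

C-suc-upper : ∀ m k → n ≡ m + k → suc n C k ≡[ suc n / suc m ] n C k
C-suc-upper m k refl = ratio (begin
  suc m * ((suc m + k) C k)      ≡⟨ cong (suc m *_) (C-sym (suc m) k) ⟩
  suc m * ((suc m + k) C suc m)  ≡⟨ cross-multiplied (C-absorption (m + k) m) ⟩
  suc (m + k) * ((m + k) C m)    ≡⟨ cong (suc (m + k) *_) (C-sym m k) ⟨
  suc (m + k) * ((m + k) C k)    ∎)
  where open ≡-Reasoning

C-suc-upper-double : ∀ j b → (suc j + 2 * b) C b ≡[ suc j + 2 * b / suc j + b ] (j + 2 * b) C b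
C-suc-upper-double j b = C-suc-upper (j + b) b (regroup j b)
  where
  regroup : ∀ j b → j + 2 * b ≡ j + b + b
  regroup = solve-∀

nCk>0 : k ≤ n → 0 < n C k
nCk>0 {zero}  _ = z<s
nCk>0 {suc k} {suc n} (s≤s k≤n) = begin-strict
  0                  <⟨ nCk>0 k≤n ⟩
  n C k              ≤⟨ m≤m+n (n C k) (n C suc k) ⟩
  n C k + n C suc k  ≡⟨ nCk+nC[k+1]≡[n+1]C[k+1] n k ⟩
  suc n C suc k      ∎
  where open ≤-Reasoning

central : ℕ → ℕ
central n = (2 * n) C n

central>0 : ∀ n → 0 < central n
central>0 n = nCk>0 (m≤m+n n (1 * n))

central-suc : ∀ n → central (suc n) ≡[ 2 * suc (2 * n) / suc n ] central n
central-suc n = ratio (*-cancelˡ-≡ _ _ (suc n) (begin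
  suc n * (suc n * central (suc n))
    ≡⟨ cong (λ r → suc n * (suc n * (r C suc n))) (*-suc 2 n) ⟩
  suc n * (suc n * (suc (suc m) C suc n))
    ≡⟨ cong (suc n *_) (cross-multiplied (C-absorption (suc m) n)) ⟩
  suc n * (suc (suc m) * (suc m C n))
    ≡⟨ x∙yz≈y∙xz (suc n) (suc (suc m)) (suc m C n) ⟩
  suc (suc m) * (suc n * (suc m C n))
    ≡⟨ cong (suc (suc m) *_) (cross-multiplied upper) ⟩
  suc (suc m) * (suc m * central n)
    ≡⟨ regroup n (suc m) (central n) ⟩
  suc n * (2 * suc m * central n)
    ∎))
  where
  open ≡-Reasoning
  m : ℕ
  m = 2 * n
  upper : suc m C n ≡[ suc m / suc n ] m C n
  upper = C-suc-upper n n (cong (n +_) (+-identityʳ n))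
  regroup : ∀ n y z → (2 + 2 * n) * (y * z) ≡ suc n * (2 * y * z)
  regroup = solve-∀

central<product-suc : ∀ m b → central (2 + m + b) < central (2 + m) * ((m + 2 * b) C b) →
                      central (3 + m + b) < central (3 + m) * ((suc m + 2 * b) C b)
central<product-suc m b = ≡[/]-preserves-<
  (central-suc (2 + m + b))
  (≡[/]-* (central-suc (2 + m)) (C-suc-upper-double m b))
  (≤-trans (m≤m+n _ _) (≤-reflexive (sym (coefficients m b))))
  where
  coefficients : ∀ m b → 2 * suc (2 * (2 + m)) * (suc m + 2 * b) * (3 + m + b)
                       ≡ 2 * suc (2 * (2 + m + b)) * ((3 + m) * (suc m + b))
                         + 4 * b * ((2 + m) * (3 + m + b) + 1)
  coefficients = solve-∀

product<central-at-3 : ∀ b → 0 < b → central 3 * ((1 + 2 * b) C b) < central (3 + b)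
product<central-at-3 b@(suc _) _ = ≡[/]-common-< {{>-nonZero (central>0 b)}}
  (≡[/]-scale (central 3) (C-suc-upper-double 0 b))
  (≡[/]-trans (central-suc (2 + b)) (≡[/]-trans (central-suc (1 + b)) (central-suc b)))
  (<-≤-trans (m<m+n _ z<s) (≤-reflexive (sym (coefficients b))))
  where
  coefficients : ∀ b → 2 * suc (2 * (2 + b)) * (2 * suc (2 * (1 + b)) * (2 * suc (2 * b)))
                         * (1 + b)
                     ≡ 20 * (1 + 2 * b) * ((3 + b) * ((2 + b) * (1 + b)))
                       + 4 * (1 + b) * (1 + 2 * b) * b * (7 + 3 * b)
  coefficients = solve-∀

central<product-at-4 : ∀ b → 0 < b → central (4 + b) < central 4 * ((2 + 2 * b) C b)
central<product-at-4 b@(suc _) _ = ≡[/]-common-< {{>-nonZero (central>0 b)}}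
  (≡[/]-trans (central-suc (3 + b))
    (≡[/]-trans (central-suc (2 + b)) (≡[/]-trans (central-suc (1 + b)) (central-suc b))))
  (≡[/]-scale (central 4) (≡[/]-trans (C-suc-upper-double 1 b) (C-suc-upper-double 0 b)))
  (<-≤-trans (m<m+n _ z<s) (≤-reflexive (sym (coefficients b))))
  where
  coefficients : ∀ b → 70 * ((2 + 2 * b) * (1 + 2 * b))
                         * ((4 + b) * ((3 + b) * ((2 + b) * (1 + b))))
                     ≡ 2 * suc (2 * (3 + b)) * (2 * suc (2 * (2 + b))
                         * (2 * suc (2 * (1 + b)) * (2 * suc (2 * b)))) * ((2 + b) * (1 + b))
                       + 4 * (1 + b) * (2 + b) * (1 + 2 * b) * b * (97 + 40 * b + 3 * b * b)
  coefficients = solve-∀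

central<product : ∀ c b → 0 < b →
                  central (4 + c + b) < central (4 + c) * ((2 + c + 2 * b) C b)
central<product zero    b b>0 = central<product-at-4 b b>0
central<product (suc c) b b>0 = central<product-suc (2 + c) b (central<product c b b>0)

lemma2p4 : (k a b : ℕ) → 0 < a → 0 < b → k ≡ a + b → 4 < 2 * a → 2 * a ≤ k →
    (2 * k) C k ≢ ((2 * a) C a) * ((a + 2 * b ∸ 2) C b)
lemma2p4 _ 0 _ _ _ _ () _
lemma2p4 _ 1 _ _ _ _ (s≤s (s≤s ())) _
lemma2p4 _ 2 _ _ _ _ (s≤s (s≤s (s≤s (s≤s ())))) _
lemma2p4 _ 3 b _ b>0 refl _ _ = >⇒≢ (product<central-at-3 b b>0)
lemma2p4 _ (suc (suc (suc (suc c)))) b _ b>0 refl _ _ = <⇒≢ (central<product c b b>0)
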